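{- Let $N$ be a 0,1-network with reactions $y_1\to y_1',\dots,y_m\to y_m'$, let $\mathscr E$ be a multiset over the edges of $\mathcal H_N$, and let $u_j$ be a vertex of $\mathcal H_N$. If $u_j$ is almost balanced with respect to the 2-coloring $\mathscr E=\mathscr E_r\sqcup\mathscr E_b$, then for some positive integer $k$, $$k\kappa_j x^{y_j}=\sum_{E_s\in\mathscr E_b}\dot x_s-\sum_{E_s\in\mathscr E_r}\dot x_s,$$ where the sums run over the species hyperedges in $\mathscr E_b$ (resp. $\mathscr E_r$), each counted with its multiplicity.
   Context: A chemical reaction network $N=(\mathscr S,\mathscr C,\mathscr R)$ consists of a finite set of species $\mathscr S$, complexes $\mathscr C\subseteq\mathbb Z_{\ge0}^{\mathscr S}$, and reactions $y\to y'$ with $y\ne y'$; every complex occurs in some reaction, every species lies in some complex's support, and there are no reactions $\varnothing\to y$. Reactions are indexed $1,\dots,m$, the $i$-th written $y_i\to y_i'$ with rate constant $\kappa_i$. $N$ is a 0,1-network if every complex lies in $\{0,1\}^{\mathscr S}$. $x^y=\prod_s x_s^{y_s}$, and $\dot x_s=\sum_i\kappa_i x^{y_i}(y'_{i,s}-y_{i,s})\in\mathbb K(\kappa)[x]$ is the steady-state polynomial of species $s$ ($\kappa_i$ indeterminates, $\mathbb K$ a field). The network hypergraph $\mathcal H_N$ has $2m$ vertices $u_1,v_1,\dots,u_m,v_m$ ($u_i$ represents the reactant $y_i$ of reaction $i$, $v_i$ its product $y_i'$). Hyperedges: for each species $s$, the species hyperedge $E_s=\{u_i: s\in\mathrm{supp}(y_i)\}\cup\{v_i: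 s\in\mathrm{supp}(y_i')\}$; for each reaction $i$, the reaction hyperedge $E_i=\{u_i,v_i\}$ if $y_i'\ne\varnothing$ and $E_i=\varnothing$ otherwise. A multiset $\mathscr E$ over the edges assigns nonnegative multiplicities; a 2-coloring $\mathscr E=\mathscr E_r\sqcup\mathscr E_b$ splits it into two submultisets whose multiplicities add up. $\deg_{\mathscr E_c}(w)$ is the number of edges of $\mathscr E_c$, with multiplicity, containing $w$. A vertex $w$ is almost balanced with respect to the 2-coloring if $\deg_{\mathscr E_r}(w)=\deg_{\mathscr E_b}(w)+k$ for some positive integer $k$ and $\deg_{\mathscr E_r}(z)=\deg_{\mathscr E_b}(z)$ for every other vertex $z$. -}

module Defs where

open import Level using (Level)
open import Data.Nat using (ℕ; zero; suc) renaming (_+_ to _+ℕ_)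
open import Data.Fin using (Fin; zero; suc)
open import Data.Bool using (Bool; true; false; if_then_else_; _∧_; _∨_)
open import Data.Sum using (_⊎_; inj₁; inj₂)
open import Data.Product using (Σ; ∃; _×_; _,_)
open import Relation.Binary.PropositionalEquality using (_≡_; _≢_)
open import Relation.Nullary using (¬_)
open import Algebra.Bundles using (CommutativeRing)

∑ℕ : (n : ℕ) → (Fin n → ℕ) → ℕ
∑ℕ zero    f = 0
∑ℕ (suc n) f = f zero +ℕ ∑ℕ n (λ i → f (suc i))

-- 0,1-networks with species Fin n and reactions Fin m.
-- A complex in {0,1}^S is a function Fin n → Bool (its support).
-- Reaction i is  reactant i → product i.

record Network01 (n m : ℕ) : Set where
  field
    reactant : Fin m → Fin n → Bool
    product  : Fin m → Fin n → Bool
    reactant≠product : ∀ i → ¬ (∀ s → reactant i s ≡ product i s)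
    reactantNonempty : ∀ i → ∃ λ s → reactant i s ≡ true
    speciesUsed : ∀ s → ∃ λ i → (reactant i s ≡ true) ⊎ (product i s ≡ true)
    reactionsDistinct : ∀ i j → (∀ s → reactant i s ≡ reactant j s)
                              → (∀ s → product i s ≡ product j s) → i ≡ j

-- vertices u_i (reactant of reaction i) and v_i (product of reaction i)
data Vertex (m : ℕ) : Set where
  u : Fin m → Vertex m
  v : Fin m → Vertex m

-- edge labels: species hyperedges E_s and reaction hyperedges E_i
Edge : ℕ → ℕ → Set
Edge n m = Fin n ⊎ Fin m

nonempty : {n : ℕ} → (Fin n → Bool) → Bool
nonempty {zero}  y = false
nonempty {suc n} y = y zero ∨ nonempty (λ i → y (suc i))

open import Data.Fin using (_≟_)
open import Relation.Nullary using (does)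

_∈E_ : ∀ {n m} {N : Network01 n m} → Vertex m → Edge n m → Bool
_∈E_ {N = N} (u i) (inj₁ s) = Network01.reactant N i s
_∈E_ {N = N} (v i) (inj₁ s) = Network01.product N i s
_∈E_ {N = N} (u i) (inj₂ j) = nonempty (Network01.product N j) ∧ does (i ≟ j)
_∈E_ {N = N} (v i) (inj₂ j) = nonempty (Network01.product N j) ∧ does (i ≟ j)

memb : ∀ {n m} (N : Network01 n m) → Vertex m → Edge n m → Bool
memb N w e = _∈E_ {N = N} w e

Multiset : ℕ → ℕ → Set
Multiset n m = Edge n m → ℕ

deg : ∀ {n m} (N : Network01 n m) → Multiset n m → Vertex m → ℕ
deg {n} {m} N E w =
    ∑ℕ n (λ s → if memb N w (inj₁ s) then E (inj₁ s) else 0)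
  +ℕ ∑ℕ m (λ i → if memb N w (inj₂ i) then E (inj₂ i) else 0)

IsTwoColoring : ∀ {n m} → Multiset n m → Multiset n m → Multiset n m → Set
IsTwoColoring E Er Eb = ∀ e → E e ≡ Er e +ℕ Eb e

AlmostBalanced : ∀ {n m} (N : Network01 n m) → Multiset n m → Multiset n m → Vertex m → Set
AlmostBalanced N Er Eb w =
  (Σ ℕ λ k → (k ≢ 0) × (deg N Er w ≡ deg N Eb w +ℕ k))
  × (∀ z → z ≢ w → deg N Er z ≡ deg N Eb z)

-- Steady-state polynomials, evaluated in an arbitrary commutative ring.

module Poly {c ℓ : Level} (R : CommutativeRing c ℓ) where
  open CommutativeRing R using (Carrier; _+_; _*_; -_; _-_; 0#; 1#)

  ∑ : (n : ℕ) → (Fin n → Carrier) → Carrier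
  ∑ zero    f = 0#
  ∑ (suc n) f = f zero + ∑ n (λ i → f (suc i))

  ∏ : (n : ℕ) → (Fin n → Carrier) → Carrier
  ∏ zero    f = 1#
  ∏ (suc n) f = f zero * ∏ n (λ i → f (suc i))

  _·_ : ℕ → Carrier → Carrier
  zero  · a = 0#
  suc k · a = a + (k · a)

  bit : Bool → Carrier
  bit true  = 1#
  bit false = 0#

  mono : ∀ {n} → (Fin n → Carrier) → (Fin n → Bool) → Carrier
  mono {n} x y = ∏ n (λ s → if y s then x s else 1#)

  ẋ : ∀ {n m} (N : Network01 n m) → (Fin m → Carrier) → (Fin n → Carrier) → Fin n → Carrier
  ẋ {n} {m} N κ x s =
    ∑ m (λ i → (κ i * mono x (Network01.reactant N i))
               * (bit (Network01.product N i s) - bit (Network01.reactant N i s)))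

  ∑species : ∀ {n m} (N : Network01 n m) → Multiset n m
           → (Fin m → Carrier) → (Fin n → Carrier) → Carrier
  ∑species {n} N E κ x = ∑ n (λ s → E (inj₁ s) · ẋ N κ x s)

IdentityHolds : ∀ {n m} (N : Network01 n m) (Er Eb : Multiset n m) (j : Fin m) (k : ℕ)
  → ∀ {c ℓ} (R : CommutativeRing c ℓ)
  → (Fin m → CommutativeRing.Carrier R) → (Fin n → CommutativeRing.Carrier R) → Set ℓ
IdentityHolds N Er Eb j k R κ x =
  k · (κ j * mono x (Network01.reactant N j)) ≈ ∑species N Eb κ x - ∑species N Er κ x
  where open CommutativeRing R using (_≈_; _*_; _-_)
        open Poly R

module Submission where

-- Write r_i = κ_i x^{y_i} and let d_X(y) count the species hyperedges of X through the
-- complex y.  Exchanging sums, Σ_{E_s ∈ X} ẋ_s = Σ_i r_i (d_X(y'_i) − d_X(y_i)), so the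
-- coefficient of r_i in Σ_b ẋ_s − Σ_r ẋ_s is (deg_r(u_i) − deg_b(u_i)) − (deg_r(v_i) − deg_b(v_i)):
-- the reaction hyperedges cancel, since E_i contains u_i exactly when it contains v_i.
-- Almost balancedness of u_j makes this coefficient k for i = j and 0 otherwise.

open import Defs
open import Level using (Level)
open import Data.Nat using (ℕ; zero; suc) renaming (_+_ to _+ℕ_)
open import Data.Nat.Properties using (+-assoc; +-cancelʳ-≡)
open import Data.Nat.Tactic.RingSolver using (solve)
open import Data.Fin using (Fin; zero; suc; punchIn)
open import Data.Fin.Properties using (punchInᵢ≢i)
open import Data.Bool using (Bool; true; false; if_then_else_)
open import Data.Sum using (inj₁)
open import Data.List using ([]; _∷_)
open import Function using (_∘_)
open import Relation.Binary.PropositionalEquality as ≡ using (_≡_; _≢_; cong)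
open import Algebra.Bundles using (CommutativeRing)

+-balance-transfer : ∀ {a b c d t t′ k} → a +ℕ t ≡ (b +ℕ t′) +ℕ k → c +ℕ t ≡ d +ℕ t′
                   → d +ℕ a ≡ (b +ℕ c) +ℕ k
+-balance-transfer {a} {b} {c} {d} {t} {t′} {k} a≡b+k c≡d = +-cancelʳ-≡ t _ _ (begin
  (d +ℕ a) +ℕ t            ≡⟨ +-assoc d a t ⟩
  d +ℕ (a +ℕ t)            ≡⟨ cong (d +ℕ_) a≡b+k ⟩
  d +ℕ ((b +ℕ t′) +ℕ k)    ≡⟨ solve (d ∷ b ∷ t′ ∷ k ∷ []) ⟩
  ((d +ℕ t′) +ℕ b) +ℕ k    ≡⟨ cong (λ z → (z +ℕ b) +ℕ k) (≡.sym c≡d) ⟩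
  ((c +ℕ t) +ℕ b) +ℕ k     ≡⟨ solve (c ∷ t ∷ b ∷ k ∷ []) ⟩
  ((b +ℕ c) +ℕ k) +ℕ t     ∎)
  where open ≡.≡-Reasoning

speciesDegree : ∀ {n m} → Multiset n m → (Fin n → Bool) → ℕ
speciesDegree {n} X y = ∑ℕ n (λ s → if y s then X (inj₁ s) else 0)

-- deg N X (u i) and deg N X (v i) unfold to the same reaction-hyperedge summand.
species-balance : ∀ {n m} (N : Network01 n m) (Er Eb : Multiset n m) (i : Fin m) (k : ℕ)
  → deg N Er (u i) ≡ deg N Eb (u i) +ℕ k → deg N Er (v i) ≡ deg N Eb (v i)
  → let open Network01 N in
    speciesDegree Eb (product i) +ℕ speciesDegree Er (reactant i)
      ≡ (speciesDegree Eb (reactant i) +ℕ speciesDegree Er (product i)) +ℕ k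
species-balance N Er Eb i k = +-balance-transfer
  {a = speciesDegree Er (reactant i)} {b = speciesDegree Eb (reactant i)}
  {c = speciesDegree Er (product i)} {d = speciesDegree Eb (product i)}
  where open Network01 N

module _ {c ℓ : Level} (R : CommutativeRing c ℓ) where
  open CommutativeRing R hiding (zero)
  open Poly R
  open import Algebra.Properties.Semiring.Sum semiring
    using (sum; sum-cong-≋; sum-cong-≗; ∑-distrib-+; ∑-comm; *-distribˡ-sum; sum-remove; sum-replicate; sum-replicate-zero)
  open import Algebra.Properties.Semiring.Mult semiring using (_×_; ×-homo-+; ×-congʳ; ×-comm-*)
  open import Algebra.Properties.CommutativeMonoid.Mult +-commutativeMonoid using (×-distrib-+)
  open import Algebra.Properties.Ring ring using (-1*x≈-x; x[y-z]≈xy-xz)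
  open import Algebra.Properties.AbelianGroup +-abelianGroup using (⁻¹-anti-homo‿-; ⁻¹-∙-comm; xyx⁻¹≈y)
  open import Algebra.Properties.CommutativeSemigroup +-commutativeSemigroup using (interchange)
  open import Relation.Binary.Reasoning.Setoid setoid

  ∑≡sum : ∀ n (f : Fin n → Carrier) → ∑ n f ≡ sum f
  ∑≡sum zero    f = ≡.refl
  ∑≡sum (suc n) f = cong (f zero +_) (∑≡sum n (f ∘ suc))

  ·≡× : ∀ k a → k · a ≡ k × a
  ·≡× zero    a = ≡.refl
  ·≡× (suc k) a = cong (a +_) (·≡× k a)

  x+w≈y+z+k⇒[x-y]-[z-w]≈k : ∀ {x y z w k} → x + w ≈ (y + z) + k → (x - y) - (z - w) ≈ k
  x+w≈y+z+k⇒[x-y]-[z-w]≈k {x} {y} {z} {w} {k} x+w≈y+z+k = begin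
    (x - y) - (z - w)        ≈⟨ +-congˡ (⁻¹-anti-homo‿- z w) ⟩
    (x - y) + (w - z)        ≈⟨ interchange x (- y) w (- z) ⟩
    (x + w) + (- y - z)      ≈⟨ +-cong x+w≈y+z+k (⁻¹-∙-comm y z) ⟩
    ((y + z) + k) - (y + z)  ≈⟨ xyx⁻¹≈y (y + z) k ⟩
    k                        ∎

  ×-zeroʳ : ∀ n → n × 0# ≈ 0#
  ×-zeroʳ n = trans (sym (sum-replicate n)) (sum-replicate-zero n)

  ×-neg : ∀ n a → n × (- a) ≈ - (n × a)
  ×-neg n a = begin
    n × (- a)         ≈⟨ ×-congʳ n (sym (-1*x≈-x a)) ⟩
    n × (- 1# * a)    ≈⟨ ×-comm-* n (- 1#) a ⟨
    - 1# * (n × a)    ≈⟨ -1*x≈-x (n × a) ⟩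
    - (n × a)         ∎

  ×-distrib-− : ∀ n a b → n × (a - b) ≈ n × a - n × b
  ×-distrib-− n a b = trans (×-distrib-+ a (- b) n) (+-congˡ (×-neg n b))

  ×-distrib-sum : ∀ n {m} (f : Fin m → Carrier) → n × sum f ≈ sum (λ i → n × f i)
  ×-distrib-sum zero    {m} f = sym (sum-replicate-zero m)
  ×-distrib-sum (suc n)     f = trans (+-congˡ (×-distrib-sum n f)) (sym (∑-distrib-+ f _))

  ×-bit : ∀ n b → n × bit b ≈ (if b then n else 0) × 1#
  ×-bit n true  = refl
  ×-bit n false = ×-zeroʳ n

  sum-×-bit : ∀ {n} (f : Fin n → ℕ) (y : Fin n → Bool)
            → sum (λ s → f s × bit (y s)) ≈ ∑ℕ n (λ s → if y s then f s else 0) × 1#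
  sum-×-bit {zero}  f y = refl
  sum-×-bit {suc n} f y = begin
    f zero × bit (y zero) + sum (λ s → f (suc s) × bit (y (suc s)))
      ≈⟨ +-cong (×-bit (f zero) (y zero)) (sum-×-bit (f ∘ suc) (y ∘ suc)) ⟩
    g zero × 1# + ∑ℕ n (g ∘ suc) × 1#
      ≈⟨ ×-homo-+ 1# (g zero) (∑ℕ n (g ∘ suc)) ⟨
    ∑ℕ (suc n) g × 1# ∎
    where
    g : Fin (suc n) → ℕ
    g s = if y s then f s else 0

  sum-neg : ∀ {n} (f : Fin n → Carrier) → sum (λ i → - f i) ≈ - sum f
  sum-neg f = begin
    sum (λ i → - f i)       ≈⟨ sum-cong-≋ (λ i → sym (-1*x≈-x (f i))) ⟩
    sum (λ i → - 1# * f i)  ≈⟨ *-distribˡ-sum (- 1#) f ⟨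
    - 1# * sum f            ≈⟨ -1*x≈-x (sum f) ⟩
    - sum f                 ∎

  sum-distrib-− : ∀ {n} (f g : Fin n → Carrier) → sum (λ i → f i - g i) ≈ sum f - sum g
  sum-distrib-− f g = trans (∑-distrib-+ f (λ i → - g i)) (+-congˡ (sum-neg g))

  sum-supported-at : ∀ {n} (f : Fin n → Carrier) (j : Fin n) → (∀ i → i ≢ j → f i ≈ 0#) → sum f ≈ f j
  sum-supported-at {suc n} f j f≈0 = begin
    sum f                               ≈⟨ sum-remove f ⟩
    f j + sum (f ∘ punchIn j)  ≈⟨ +-congˡ (sum-cong-≋ {n} (λ i → f≈0 (punchIn j i) (punchInᵢ≢i j i))) ⟩
    f j + sum {n} (λ _ → 0#)            ≈⟨ +-congˡ (sum-replicate-zero n) ⟩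
    f j + 0#                            ≈⟨ +-identityʳ (f j) ⟩
    f j                                 ∎

  module _ {n m : ℕ} (N : Network01 n m) (κ : Fin m → Carrier) (x : Fin n → Carrier) where
    open Network01 N

    rate : Fin m → Carrier
    rate i = κ i * mono x (reactant i)

    stoichiometry : Fin m → Fin n → Carrier
    stoichiometry i s = bit (product i s) - bit (reactant i s)

    netDegree : Multiset n m → Fin m → Carrier
    netDegree X i = speciesDegree X (product i) × 1# - speciesDegree X (reactant i) × 1#

    ∑species≈sum : ∀ X → ∑species N X κ x ≈ sum (λ s → X (inj₁ s) × sum (λ i → rate i * stoichiometry i s))
    ∑species≈sum X = reflexive (≡.trans (∑≡sum n _) (sum-cong-≗ (λ s →
      ≡.trans (·≡× (X (inj₁ s)) _) (cong (X (inj₁ s) ×_) (∑≡sum m _)))))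

    sum-×-stoichiometry : ∀ X i → sum (λ s → X (inj₁ s) × stoichiometry i s) ≈ netDegree X i
    sum-×-stoichiometry X i = begin
      sum (λ s → X (inj₁ s) × stoichiometry i s)
        ≈⟨ sum-cong-≋ (λ s → ×-distrib-− (X (inj₁ s)) _ _) ⟩
      sum (λ s → X (inj₁ s) × bit (product i s) - X (inj₁ s) × bit (reactant i s))
        ≈⟨ sum-distrib-− (λ s → X (inj₁ s) × bit (product i s)) (λ s → X (inj₁ s) × bit (reactant i s)) ⟩
      sum (λ s → X (inj₁ s) × bit (product i s)) - sum (λ s → X (inj₁ s) × bit (reactant i s))
        ≈⟨ +-cong (sum-×-bit _ (product i)) (-‿cong (sum-×-bit _ (reactant i))) ⟩
      netDegree X i ∎

    ∑species-by-reaction : ∀ X → ∑species N X κ x ≈ sum (λ i → rate i * netDegree X i)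
    ∑species-by-reaction X = begin
      ∑species N X κ x
        ≈⟨ ∑species≈sum X ⟩
      sum (λ s → X (inj₁ s) × sum (λ i → rate i * stoichiometry i s))
        ≈⟨ sum-cong-≋ (λ s → ×-distrib-sum (X (inj₁ s)) (λ i → rate i * stoichiometry i s)) ⟩
      sum (λ s → sum (λ i → X (inj₁ s) × (rate i * stoichiometry i s)))
        ≈⟨ sum-cong-≋ (λ s → sum-cong-≋ (λ i → ×-comm-* (X (inj₁ s)) (rate i) _)) ⟨
      sum (λ s → sum (λ i → rate i * (X (inj₁ s) × stoichiometry i s)))
        ≈⟨ ∑-comm (λ s i → rate i * (X (inj₁ s) × stoichiometry i s)) ⟩
      sum (λ i → sum (λ s → rate i * (X (inj₁ s) × stoichiometry i s)))
        ≈⟨ sum-cong-≋ (λ i → *-distribˡ-sum (rate i) (λ s → X (inj₁ s) × stoichiometry i s)) ⟨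
      sum (λ i → rate i * sum (λ s → X (inj₁ s) × stoichiometry i s))
        ≈⟨ sum-cong-≋ (λ i → *-congˡ (sum-×-stoichiometry X i)) ⟩
      sum (λ i → rate i * netDegree X i) ∎

    netDegree-excess : ∀ (Er Eb : Multiset n m) i k
      → deg N Er (u i) ≡ deg N Eb (u i) +ℕ k → deg N Er (v i) ≡ deg N Eb (v i)
      → netDegree Eb i - netDegree Er i ≈ k × 1#
    netDegree-excess Er Eb i k balanced-u balanced-v = x+w≈y+z+k⇒[x-y]-[z-w]≈k (begin
      pb × 1# + rr × 1#             ≈⟨ ×-homo-+ 1# pb rr ⟨
      (pb +ℕ rr) × 1#               ≡⟨ cong (_× 1#) (species-balance N Er Eb i k balanced-u balanced-v) ⟩
      ((rb +ℕ pr) +ℕ k) × 1#        ≈⟨ ×-homo-+ 1# (rb +ℕ pr) k ⟩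
      (rb +ℕ pr) × 1# + k × 1#      ≈⟨ +-congʳ (×-homo-+ 1# rb pr) ⟩
      (rb × 1# + pr × 1#) + k × 1#  ∎)
      where
      pb = speciesDegree Eb (product i)
      rb = speciesDegree Eb (reactant i)
      pr = speciesDegree Er (product i)
      rr = speciesDegree Er (reactant i)

    excess-identity : ∀ (Er Eb : Multiset n m) j k
      → deg N Er (u j) ≡ deg N Eb (u j) +ℕ k → (∀ z → z ≢ u j → deg N Er z ≡ deg N Eb z)
      → k · rate j ≈ ∑species N Eb κ x - ∑species N Er κ x
    excess-identity Er Eb j k excess-u balanced = sym (begin
      ∑species N Eb κ x - ∑species N Er κ x
        ≈⟨ +-cong (∑species-by-reaction Eb) (-‿cong (∑species-by-reaction Er)) ⟩
      sum (λ i → rate i * netDegree Eb i) - sum (λ i → rate i * netDegree Er i)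
        ≈⟨ sum-distrib-− (λ i → rate i * netDegree Eb i) (λ i → rate i * netDegree Er i) ⟨
      sum (λ i → rate i * netDegree Eb i - rate i * netDegree Er i)
        ≈⟨ sum-cong-≋ (λ i → x[y-z]≈xy-xz (rate i) _ _) ⟨
      sum (λ i → rate i * (netDegree Eb i - netDegree Er i))
        ≈⟨ sum-supported-at _ j vanishes-off-j ⟩
      rate j * (netDegree Eb j - netDegree Er j)
        ≈⟨ *-congˡ (netDegree-excess Er Eb j k excess-u (balanced (v j) λ ())) ⟩
      rate j * (k × 1#)
        ≈⟨ ×-comm-* k (rate j) 1# ⟩
      k × (rate j * 1#)
        ≈⟨ ×-congʳ k (*-identityʳ (rate j)) ⟩
      k × rate j
        ≡⟨ ·≡× k (rate j) ⟨
      k · rate j ∎)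
      where
      vanishes-off-j : ∀ i → i ≢ j → rate i * (netDegree Eb i - netDegree Er i) ≈ 0#
      vanishes-off-j i i≢j = trans (*-congˡ (netDegree-excess Er Eb i 0
        (≡.trans (balanced (u i) λ { ≡.refl → i≢j ≡.refl }) (≡.sym (Data.Nat.Properties.+-identityʳ _)))
        (balanced (v i) λ ()))) (zeroʳ (rate i))

open import Data.Product using (Σ; _×_; _,_)

proposition3p4 : ∀ {c ℓ : Level} {n m : ℕ} (N : Network01 n m) (E Er Eb : Multiset n m) (j : Fin m)
    → IsTwoColoring E Er Eb
    → AlmostBalanced N Er Eb (u j)
    → Σ ℕ λ k → (k ≢ 0) ×
        ((R : CommutativeRing c ℓ)
           (κ : Fin m → CommutativeRing.Carrier R) (x : Fin n → CommutativeRing.Carrier R)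
           → IdentityHolds N Er Eb j k R κ x)
-- Only the colour classes Er and Eb enter the identity, so the coloring hypothesis is unused.
proposition3p4 N E Er Eb j _ ((k , k≢0 , excess-u) , balanced) =
  k , k≢0 , λ R κ x → excess-identity R N κ x Er Eb j k excess-u balanced
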